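{- Let $f=\sum_{\mathbf{u}\in\mathbb{F}_q^{n+d}}c_{\mathbf{u}}x_{\mathbf{u}}\in\mathbb{C}[\mathbb{F}_q^{n+d}]$ with $c_{\mathbf{u}}=q^{dn}$ if $\mathbf{u}=\mathbf{0}$, $c_{\mathbf{u}}=q^{d(n-1)}$ if $\mathbf{u}|_{[n]}\neq\mathbf{0}$, and $c_{\mathbf{u}}=0$ otherwise. Then the matrix of the operator $\phi_f$ with respect to the standard basis $\{x_{\mathbf{u}}:\mathbf{u}\in\mathbb{F}_q^{n+d}\}$ is $\mathbf{T}^*\mathbf{T}$; that is, for all $\mathbf{u},\mathbf{v}$, the coefficient of $x_{\mathbf{u}}$ in $\phi_f(x_{\mathbf{v}})$ equals $(\mathbf{T}^*\mathbf{T})_{\mathbf{u},\mathbf{v}}$.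
   Context: Setting: $q$ a prime power, $n,d$ positive integers; $h_1,\ldots,h_d\in\mathbb{F}_q[x_1,\ldots,x_n]$ fixed of total degree at most $q-1$; $\mathbf{b}_i\in(\mathbb{Z}^+)^n$ fixed with $\gcd(b_{i,j},q-1)=1$; $f_{\mathbf{a}_i}(x)=\sum_{j=1}^n a_{i,j}x_j^{b_{i,j}}+a_{i,n+1}$ for $\mathbf{a}_i\in\mathbb{F}_q^{n+1}$; $V_{\mathbf{a}_1,\ldots,\mathbf{a}_d}=\{x\in\mathbb{F}_q^{n+d}: x_{n+i}=h_i(x_1,\ldots,x_n)+f_{\mathbf{a}_i}(x_1,\ldots,x_n)\ \forall i\}$. $\mathbf{T}$ is the $q^{d(n+1)}\times q^{n+d}$ 0/1 incidence matrix, rows indexed by $(\mathbf{a}_1,\ldots,\mathbf{a}_d)\in(\mathbb{F}_q^{n+1})^d$, columns by points of $\mathbb{F}_q^{n+d}$, entry $1$ iff the point lies in $V_{\mathbf{a}_1,\ldots,\mathbf{a}_d}$. The group algebra $\mathbb{C}[\mathbb{F}_q^{m}]$ consists of formal sums $\sum_{\mathbf{u}}c_{\mathbf{u}}x_{\mathbf{u}}$, with componentwise addition and product $(\sum c_{\mathbf{u}}x_{\mathbf{u}})(\sum\tilde c_{\mathbf{u}}x_{\mathbf{u}})=\sum_{\mathbf{u}}(\sum_{\tilde{\mathbf{u}}}c_{\mathbf{u}-\tilde{\mathbf{u}}}\tilde c_{\tilde{\mathbf{u}}})x_{\mathbf{u}}$. For $z$ in the algebra, $\phi_z(g)=z\cdot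 g$. $\mathbf{u}|_{[n]}$ denotes the first $n$ coordinates. -}

module Defs where

open import Level using (0ℓ)
open import Data.Nat as ℕ using (ℕ; zero; suc; _≤_; _∸_)
open import Data.Nat.Coprimality using (Coprime)
open import Data.Fin using (Fin; inject₁; fromℕ) renaming (zero to fzero; suc to fsuc)
open import Data.Fin.Properties using (all?)
open import Data.Vec as Vec using (Vec; []; _∷_; lookup; take; drop; zipWith; replicate)
open import Data.Vec.Properties using (≡-dec)
open import Data.List as List using (List; []; _∷_; concatMap; map; foldr)
open import Data.Nat.ListAction using () renaming (sum to sumℕ)
open import Data.List.Membership.Propositional using (_∈_)
open import Data.List.Relation.Unary.Unique.Propositional using (Unique)
open import Data.List.Relation.Unary.All using (All)
open import Data.Product using (∃; _×_; _,_)
open import Data.Bool using (Bool; if_then_else_)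
open import Relation.Nullary using (does; ¬_)
open import Relation.Binary.PropositionalEquality using (_≡_; _≢_)
open import Relation.Binary.Definitions using (DecidableEquality)
open import Algebra.Structures using (IsCommutativeRing)

record FiniteField : Set₁ where
  infixl 6 _+_
  infixl 7 _*_
  field
    F      : Set
    _+_    : F → F → F
    _*_    : F → F → F
    -_     : F → F
    0#     : F
    1#     : F
    isCommutativeRing : IsCommutativeRing _≡_ _+_ _*_ -_ 0# 1#
    0≢1    : 0# ≢ 1#
    inverse : ∀ x → x ≢ 0# → ∃ λ y → x * y ≡ 1#
    _≟_    : DecidableEquality F
    elems  : List F
    elems-complete : ∀ x → x ∈ elems
    elems-unique   : Unique elems

  q : ℕ
  q = List.length elems

  pow : F → ℕ → F
  pow x zero    = 1#
  pow x (suc k) = x * pow x k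

  Σᶠ : ∀ {k} → (Fin k → F) → F
  Σᶠ {zero}  g = 0#
  Σᶠ {suc k} g = g fzero + Σᶠ (λ j → g (fsuc j))

  Πᶠ : ∀ {k} → (Fin k → F) → F
  Πᶠ {zero}  g = 1#
  Πᶠ {suc k} g = g fzero * Πᶠ (λ j → g (fsuc j))

  allVec : (k : ℕ) → List (Vec F k)
  allVec zero    = [] ∷ []
  allVec (suc k) = concatMap (λ x → map (x ∷_) (allVec k)) elems

  _≟ᵛ_ : ∀ {k} → DecidableEquality (Vec F k)
  _≟ᵛ_ = ≡-dec _≟_

  _-ᵛ_ : ∀ {k} → Vec F k → Vec F k → Vec F k
  u -ᵛ v = zipWith (λ a b → a + (- b)) u v

  0ᵛ : ∀ {k} → Vec F k
  0ᵛ = replicate _ 0#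

  -- Polynomials in F[x_1,…,x_n]: finite lists of monomials c·x^e
  Poly : ℕ → Set
  Poly n = List (F × Vec ℕ n)

  evalPoly : ∀ {n} → Poly n → Vec F n → F
  evalPoly p x = foldr (λ { (c , e) acc → c * Πᶠ (λ j → pow (lookup x j) (lookup e j)) + acc }) 0# p

  TotalDegree≤ : ∀ {n} → Poly n → ℕ → Set
  TotalDegree≤ p d₀ = All (λ { (c , e) → Vec.sum e ≤ d₀ }) p

  fa : ∀ {n} → Vec ℕ n → Vec F (suc n) → Vec F n → F
  fa {n} b a x = Σᶠ (λ j → lookup a (inject₁ j) * pow (lookup x j) (lookup b j)) + lookup a (fromℕ n)

  module _ {n d : ℕ} (h : Fin d → Poly n) (b : Fin d → Vec ℕ n) where

    inVᵇ : Vec (Vec F (suc n)) d → Vec F (n ℕ.+ d) → Bool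
    inVᵇ as p = does (all? (λ i →
      lookup (drop n p) i ≟ (evalPoly (h i) (take n p) + fa (b i) (lookup as i) (take n p))))

    -- incidence matrix T (rows: (a_1,…,a_d) ∈ (F^{n+1})^d, columns: points of F^{n+d})
    T : Vec (Vec F (suc n)) d → Vec F (n ℕ.+ d) → ℕ
    T as p = if inVᵇ as p then 1 else 0

    allRows : ∀ {k} → List (Vec (Vec F (suc n)) k)
    allRows {zero}  = [] ∷ []
    allRows {suc k} = concatMap (λ a → map (a ∷_) allRows) (allVec (suc n))

    -- (T* T)_{u,v} = Σ_r conj(T_{r,u}) T_{r,v}  (T is real 0/1, so T* = Tᵀ)
    TᵀT : Vec F (n ℕ.+ d) → Vec F (n ℕ.+ d) → ℕ
    TᵀT u v = sumℕ (map (λ r → T r u ℕ.* T r v) allRows)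

  -- Group algebra of F^m: elements as coefficient functions u ↦ c_u
  GA : ℕ → Set
  GA m = Vec F m → ℕ

  xᵇ : ∀ {m} → Vec F m → GA m
  xᵇ v u = if does (u ≟ᵛ v) then 1 else 0

  _⋆_ : ∀ {m} → GA m → GA m → GA m
  _⋆_ {m} g g̃ u = sumℕ (map (λ ũ → g (u -ᵛ ũ) ℕ.* g̃ ũ) (allVec m))

  φ : ∀ {m} → GA m → GA m → GA m
  φ z g = z ⋆ g

  fElem : (n d : ℕ) → GA (n ℕ.+ d)
  fElem n d u =
    if does (u ≟ᵛ 0ᵛ) then q ℕ.^ (d ℕ.* n)
    else if does (take n u ≟ᵛ 0ᵛ) then 0
    else q ℕ.^ (d ℕ.* (n ∸ 1))

{-# OPTIONS --safe #-}
module Submission where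

-- Multiplication by x_v translates coefficients by v, so the left-hand side is the coefficient of
-- f at u − v. On the right, (TᵀT)_{u,v} counts the tuples (a_1, …, a_d) whose variety contains
-- both u and v. Membership is a conjunction over i of "the point lies on the graph of
-- h_i + f_{a_i}", so the count is a product over i of the number of a_i whose graph contains
-- u and v. Once the first n entries a′ of a_i are fixed, the constant term is forced by u and by v,
-- so one counts the a′ for which the two forced constants agree. If u and v have the same first
-- n coordinates, this holds for all a′ or for none, according as u_{n+i} = v_{n+i}. Otherwise it
-- is a linear equation in a′ with coefficients u_j^{b_{i,j}} − v_j^{b_{i,j}}, not all zero because
-- x ↦ x^b is injective on F_q when gcd(b, q − 1) = 1 (Fermat and Bézout); so it has q^{n−1}
-- solutions.

open import Defs
open import Level using (Level)
open import Function using (_∘_; _⇔_; mk⇔; Equivalence)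
open import Function.Properties.Equivalence using () renaming (sym to ⇔-sym; trans to ⇔-trans)
open import Data.Empty using (⊥-elim)
open import Data.Product using (∃; _,_; proj₁; proj₂)
open import Data.Bool using (if_then_else_)
import Data.Nat as ℕ
open ℕ using (ℕ; zero; suc; _∸_; _≤_)
import Data.Nat.Properties as ℕ
open import Data.Nat.ListAction using () renaming (sum to sumℕ)
open import Data.Nat.ListAction.Properties using (sum-++)
open import Data.Nat.Coprimality using (Coprime; coprime-Bézout)
open import Data.Nat.GCD using (module Bézout)
open import Data.Fin using (Fin; inject₁; fromℕ) renaming (zero to fzero; suc to fsuc)
open import Data.Fin.Properties using (all?; ∀-cons-⇔)
open import Data.Vec using (Vec; []; _∷_; _∷ʳ_; lookup; take; drop) renaming (_++_ to _++ᵛ_)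
import Data.Vec.Properties as Vec
open import Data.List using (List; []; _∷_; _++_; map; concatMap; length; filter; foldr)
open import Data.List.Properties using (map-cong; map-∘; map-++)
open import Data.List.Membership.Propositional using (_∈_)
open import Data.List.Membership.Propositional.Properties
  using (∈-filter⁺; ∈-filter⁻; ∈-map⁺; ∈-map⁻)
open import Data.List.Membership.Propositional.Properties.WithK using (unique∧set⇒bag)
open import Data.List.Relation.Unary.Any using (here; there)
import Data.List.Relation.Unary.All as All
open import Data.List.Relation.Unary.AllPairs using (_∷_)
open import Data.List.Relation.Unary.Unique.Propositional using (Unique)
import Data.List.Relation.Unary.Unique.Propositional.Properties as Unique
open import Data.List.Relation.Binary.BagAndSetEquality using (∼bag⇒↭)
open import Data.List.Relation.Binary.Permutation.Propositional using (_↭_; ↭⇒↭ₛ)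
open import Data.List.Relation.Binary.Permutation.Propositional.Properties using (↭-length)
import Data.List.Relation.Binary.Permutation.Setoid.Properties as Permutation
open import Algebra.Bundles using (CommutativeRing)
open import Algebra.Properties.CommutativeSemigroup ℕ.+-commutativeSemigroup
  using () renaming (interchange to +-interchange)
open import Algebra.Properties.CommutativeMonoid.Sum ℕ.*-1-commutativeMonoid
  using () renaming (sum to ∏; sum-cong-≗ to ∏-cong; ∑-distrib-+ to ∏-distrib-*)
open import Relation.Nullary using (Dec; yes; no; does; ¬_; _×-dec_; ¬?)
open import Relation.Nullary.Decidable using (dec-true; dec-false; decidable-stable)
open import Relation.Binary.Definitions using (DecidableEquality)
open import Relation.Binary.PropositionalEquality

private
  variable
    a b p : Level
    A B : Set a
    P Q : Set p

module Counting where

  open import Data.Nat.Base using (_+_; _*_; _^_)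

  ∑ : List A → (A → ℕ) → ℕ
  ∑ xs g = sumℕ (map g xs)

  ∑-cong : ∀ (xs : List A) {g h : A → ℕ} → (∀ x → g x ≡ h x) → ∑ xs g ≡ ∑ xs h
  ∑-cong xs g≗h = cong sumℕ (map-cong g≗h xs)

  ∑-zero : ∀ (xs : List A) {g : A → ℕ} → (∀ {x} → x ∈ xs → g x ≡ 0) → ∑ xs g ≡ 0
  ∑-zero []       g≡0 = refl
  ∑-zero (x ∷ xs) g≡0 = cong₂ _+_ (g≡0 (here refl)) (∑-zero xs (g≡0 ∘ there))

  ∑-const : ∀ (xs : List A) c → ∑ xs (λ _ → c) ≡ length xs * c
  ∑-const []       c = refl
  ∑-const (x ∷ xs) c = cong (c +_) (∑-const xs c)

  ∑-+ : ∀ (xs : List A) g h → ∑ xs (λ x → g x + h x) ≡ ∑ xs g + ∑ xs h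
  ∑-+ []       g h = refl
  ∑-+ (x ∷ xs) g h =
    trans (cong (g x + h x +_) (∑-+ xs g h)) (+-interchange (g x) (h x) _ _)

  ∑-*ˡ : ∀ (xs : List A) c g → ∑ xs (λ x → c * g x) ≡ c * ∑ xs g
  ∑-*ˡ []       c g = sym (ℕ.*-zeroʳ c)
  ∑-*ˡ (x ∷ xs) c g =
    trans (cong (c * g x +_) (∑-*ˡ xs c g)) (sym (ℕ.*-distribˡ-+ c (g x) _))

  ∑-*ʳ : ∀ (xs : List A) c g → ∑ xs (λ x → g x * c) ≡ ∑ xs g * c
  ∑-*ʳ xs c g =
    trans (∑-cong xs (λ x → ℕ.*-comm (g x) c)) (trans (∑-*ˡ xs c g) (ℕ.*-comm c _))

  ∑-++ : ∀ (xs ys : List A) g → ∑ (xs ++ ys) g ≡ ∑ xs g + ∑ ys g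
  ∑-++ xs ys g = trans (cong sumℕ (map-++ g xs ys)) (sum-++ (map g xs) (map g ys))

  ∑-map : ∀ (f : B → A) (xs : List B) g → ∑ (map f xs) g ≡ ∑ xs (g ∘ f)
  ∑-map f xs g = cong sumℕ (sym (map-∘ xs))

  ∑-concatMap : ∀ (f : B → List A) (xs : List B) g →
                ∑ (concatMap f xs) g ≡ ∑ xs (λ x → ∑ (f x) g)
  ∑-concatMap f []       g = refl
  ∑-concatMap f (x ∷ xs) g =
    trans (∑-++ (f x) (concatMap f xs) g) (cong (∑ (f x) g +_) (∑-concatMap f xs g))

  ∑-comm : ∀ (xs : List A) (ys : List B) (g : A → B → ℕ) →
           ∑ xs (λ x → ∑ ys (g x)) ≡ ∑ ys (λ y → ∑ xs (λ x → g x y))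
  ∑-comm []       ys g = sym (∑-zero ys (λ _ → refl))
  ∑-comm (x ∷ xs) ys g = trans (cong (∑ ys (g x) +_) (∑-comm xs ys g))
                               (sym (∑-+ ys (g x) (λ y → ∑ xs (λ x′ → g x′ y))))

  ∑-delta : ∀ {xs : List A} {g : A → ℕ} {v} → Unique xs → v ∈ xs →
            (∀ x → x ≢ v → g x ≡ 0) → ∑ xs g ≡ g v
  ∑-delta {xs = v ∷ xs} {g} (v∉xs ∷ _) (here refl) g≡0 =
    trans (cong (g v +_) (∑-zero xs (λ x∈xs → g≡0 _ (All.lookup v∉xs x∈xs ∘ sym))))
          (ℕ.+-identityʳ _)
  ∑-delta (x∉xs ∷ xs!) (there v∈xs) g≡0 =
    cong₂ _+_ (g≡0 _ (All.lookup x∉xs v∈xs)) (∑-delta xs! v∈xs g≡0)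

  ∑-concatMap-∷ : ∀ {n} (xs : List A) (ys : List (Vec A n)) g →
                  ∑ (concatMap (λ x → map (x ∷_) ys) xs) g ≡ ∑ xs (λ x → ∑ ys (λ v → g (x ∷ v)))
  ∑-concatMap-∷ xs ys g =
    trans (∑-concatMap _ xs g) (∑-cong xs (λ x → ∑-map (x ∷_) ys g))

  ∏-const : ∀ k c → ∏ {k} (λ _ → c) ≡ c ^ k
  ∏-const zero    c = refl
  ∏-const (suc k) c = cong (c *_) (∏-const k c)

  ∏-const-^ : ∀ k c m → ∏ {k} (λ _ → c ^ m) ≡ c ^ (k * m)
  ∏-const-^ k c m =
    trans (∏-const k (c ^ m)) (trans (ℕ.^-*-assoc c m k) (cong (c ^_) (ℕ.*-comm m k)))

  ∏-zero : ∀ {k} (g : Fin k → ℕ) i → g i ≡ 0 → ∏ g ≡ 0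
  ∏-zero g fzero    g≡0 = cong (_* ∏ (λ i → g (fsuc i))) g≡0
  ∏-zero g (fsuc i) g≡0 =
    trans (cong (g fzero *_) (∏-zero (λ i → g (fsuc i)) i g≡0)) (ℕ.*-zeroʳ (g fzero))

  if-yes : ∀ {x y : A} (P? : Dec P) → P → (if does P? then x else y) ≡ x
  if-yes P? p = cong (if_then _ else _) (dec-true P? p)

  if-no : ∀ {x y : A} (P? : Dec P) → ¬ P → (if does P? then x else y) ≡ y
  if-no P? ¬p = cong (if_then _ else _) (dec-false P? ¬p)

  𝟙 : Dec P → ℕ
  𝟙 P? = if does P? then 1 else 0

  𝟙-cong : ∀ (P? : Dec P) (Q? : Dec Q) → P ⇔ Q → 𝟙 P? ≡ 𝟙 Q?
  𝟙-cong P? (yes q) P⇔Q = if-yes P? (Equivalence.from P⇔Q q)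
  𝟙-cong P? (no ¬q) P⇔Q = if-no P? (¬q ∘ Equivalence.to P⇔Q)

  𝟙-× : ∀ (P? : Dec P) (Q? : Dec Q) → 𝟙 (P? ×-dec Q?) ≡ 𝟙 P? * 𝟙 Q?
  𝟙-× (yes _) (yes _) = refl
  𝟙-× (yes _) (no _)  = refl
  𝟙-× (no _)  _       = refl

  𝟙-all : ∀ {k} {P : Fin k → Set p} (P? : ∀ i → Dec (P i)) → 𝟙 (all? P?) ≡ ∏ (λ i → 𝟙 (P? i))
  𝟙-all {k = zero}  P? = refl
  𝟙-all {k = suc k} P? = begin
    𝟙 (all? P?)                               ≡⟨ 𝟙-cong (all? P?) P₀×P₊? (⇔-sym ∀-cons-⇔) ⟩
    𝟙 P₀×P₊?                                  ≡⟨ 𝟙-× (P? fzero) (all? (P? ∘ fsuc)) ⟩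
    𝟙 (P? fzero) * 𝟙 (all? (P? ∘ fsuc))       ≡⟨ cong (𝟙 (P? fzero) *_) (𝟙-all (P? ∘ fsuc)) ⟩
    𝟙 (P? fzero) * ∏ (λ i → 𝟙 (P? (fsuc i)))  ∎
    where
    open ≡-Reasoning
    P₀×P₊? = P? fzero ×-dec all? (P? ∘ fsuc)

open Counting

∃-lookup-≢ : DecidableEquality A → ∀ {k} {xs ys : Vec A k} → xs ≢ ys →
             ∃ λ j → lookup xs j ≢ lookup ys j
∃-lookup-≢ _≟_ {xs = []}     {[]}     []≢[] = ⊥-elim ([]≢[] refl)
∃-lookup-≢ _≟_ {xs = x ∷ xs} {y ∷ ys} xs≢ys with x ≟ y
... | no x≢y   = fzero , x≢y
... | yes refl with ∃-lookup-≢ _≟_ (xs≢ys ∘ cong (x ∷_))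
...   | j , ≢ = fsuc j , ≢

lookup-∷ʳ-inject₁ : ∀ {k} (xs : Vec A k) x j → lookup (xs ∷ʳ x) (inject₁ j) ≡ lookup xs j
lookup-∷ʳ-inject₁ (y ∷ xs) x fzero    = refl
lookup-∷ʳ-inject₁ (y ∷ xs) x (fsuc j) = lookup-∷ʳ-inject₁ xs x j

lookup-∷ʳ-fromℕ : ∀ {k} (xs : Vec A k) x → lookup (xs ∷ʳ x) (fromℕ k) ≡ x
lookup-∷ʳ-fromℕ []       x = refl
lookup-∷ʳ-fromℕ (y ∷ xs) x = lookup-∷ʳ-fromℕ xs x

unique∧set⇒↭ : ∀ {xs ys : List A} → Unique xs → Unique ys → (∀ {z} → z ∈ xs ⇔ z ∈ ys) →
               xs ↭ ys
unique∧set⇒↭ xs! ys! xs∼ys = ∼bag⇒↭ (unique∧set⇒bag xs! ys! xs∼ys)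

module FiniteFieldProperties (𝔽 : FiniteField) where

  open FiniteField 𝔽

  commutativeRing : CommutativeRing _ _
  commutativeRing = record { isCommutativeRing = isCommutativeRing }

  open CommutativeRing commutativeRing public using (_-_)
  open CommutativeRing commutativeRing
    using ( +-comm; *-assoc; *-comm; *-identityˡ; *-identityʳ; zeroˡ; zeroʳ; -‿inverseʳ
          ; ring; +-commutativeSemigroup; *-commutativeSemigroup; *-isCommutativeMonoid )
  open import Algebra.Properties.Ring ring public
    using ( x[y-z]≈xy-xz; -‿+-comm; +-cancelʳ; x∙y⁻¹≈ε⇒x≈y; x≈y⇒x∙y⁻¹≈ε; x≈z//y
          ; //-rightDividesˡ; ⁻¹-anti-homo‿- )
  open import Algebra.Properties.CommutativeSemigroup +-commutativeSemigroup
    using (interchange)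
  open import Algebra.Properties.CommutativeSemigroup *-commutativeSemigroup
    using () renaming (interchange to *-interchange)
  open ≡-Reasoning

  +≡⇔≡- : ∀ {x y z} → x + y ≡ z ⇔ x ≡ z - y
  +≡⇔≡- {x} {y} {z} = mk⇔ (x≈z//y x y z) (λ { refl → //-rightDividesˡ y z })

  +≡⇔≡-ʳ : ∀ {x y z} → x + y ≡ z ⇔ y ≡ z - x
  +≡⇔≡-ʳ {x} {y} = ⇔-trans (mk⇔ (trans (+-comm y x)) (trans (+-comm x y))) +≡⇔≡-

  -≡0⇔≡ : ∀ {x y} → x - y ≡ 0# ⇔ x ≡ y
  -≡0⇔≡ = mk⇔ (x∙y⁻¹≈ε⇒x≈y _ _) x≈y⇒x∙y⁻¹≈ε

  +-−-interchange : ∀ x y z w → (x + y) - (z + w) ≡ (x - z) + (y - w)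
  +-−-interchange x y z w = begin
    (x + y) + - (z + w)    ≡⟨ cong ((x + y) +_) (-‿+-comm z w) ⟨
    (x + y) + (- z + - w)  ≡⟨ interchange x y (- z) (- w) ⟩
    (x + - z) + (y + - w)  ∎

  -≡-⇔-≡- : ∀ {x y z w} → x - y ≡ z - w ⇔ x - z ≡ y - w
  -≡-⇔-≡- = mk⇔ exchange exchange
    where
    exchange : ∀ {x y z w} → x - y ≡ z - w → x - z ≡ y - w
    exchange {x} {y} {z} {w} x-y≡z-w = Equivalence.to -≡0⇔≡ (begin
      (x - z) - (y - w)      ≡⟨ cong ((x - z) +_) (⁻¹-anti-homo‿- y w) ⟩
      (x - z) + (w - y)      ≡⟨ interchange x (- z) w (- y) ⟩
      (x + w) + (- z + - y)  ≡⟨ cong ((x + w) +_) (+-comm (- z) (- y)) ⟩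
      (x + w) + (- y + - z)  ≡⟨ interchange x (- y) w (- z) ⟨
      (x - y) + (w - z)      ≡⟨ cong ((x - y) +_) (⁻¹-anti-homo‿- z w) ⟨
      (x - y) - (z - w)      ≡⟨ Equivalence.from -≡0⇔≡ x-y≡z-w ⟩
      0#                     ∎)

  inv : ∀ x → x ≢ 0# → F
  inv x x≢0 = proj₁ (inverse x x≢0)

  inverseʳ : ∀ {x} (x≢0 : x ≢ 0#) → x * inv x x≢0 ≡ 1#
  inverseʳ {x} x≢0 = proj₂ (inverse x x≢0)

  inverseˡ : ∀ {x} (x≢0 : x ≢ 0#) → inv x x≢0 * x ≡ 1#
  inverseˡ {x} x≢0 = trans (*-comm _ x) (inverseʳ x≢0)

  inv-≢0 : ∀ {x} (x≢0 : x ≢ 0#) → inv x x≢0 ≢ 0#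
  inv-≢0 {x} x≢0 x⁻¹≡0 = 0≢1 (begin
    0#             ≡⟨ zeroʳ x ⟨
    x * 0#         ≡⟨ cong (x *_) x⁻¹≡0 ⟨
    x * inv x x≢0  ≡⟨ inverseʳ x≢0 ⟩
    1#             ∎)

  inv-cancelˡ : ∀ {x} (x≢0 : x ≢ 0#) y → inv x x≢0 * (x * y) ≡ y
  inv-cancelˡ {x} x≢0 y = begin
    inv x x≢0 * (x * y)  ≡⟨ *-assoc _ x y ⟨
    inv x x≢0 * x * y    ≡⟨ cong (_* y) (inverseˡ x≢0) ⟩
    1# * y               ≡⟨ *-identityˡ y ⟩
    y                    ∎

  *-cancelˡ-≢0 : ∀ {x y z} → x ≢ 0# → x * y ≡ x * z → y ≡ z
  *-cancelˡ-≢0 {x} {y} {z} x≢0 xy≡xz = begin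
    y                    ≡⟨ inv-cancelˡ x≢0 y ⟨
    inv x x≢0 * (x * y)  ≡⟨ cong (inv x x≢0 *_) xy≡xz ⟩
    inv x x≢0 * (x * z)  ≡⟨ inv-cancelˡ x≢0 z ⟩
    z                    ∎

  *-≢0 : ∀ {x y} → x ≢ 0# → y ≢ 0# → x * y ≢ 0#
  *-≢0 {x} x≢0 y≢0 xy≡0 = y≢0 (*-cancelˡ-≢0 x≢0 (trans xy≡0 (sym (zeroʳ x))))

  *≡⇔≡inv* : ∀ {x y z} (y≢0 : y ≢ 0#) → x * y ≡ z ⇔ x ≡ inv y y≢0 * z
  *≡⇔≡inv* {x} {y} {z} y≢0 = mk⇔
    (λ { refl → trans (sym (inv-cancelˡ y≢0 x)) (cong (inv y y≢0 *_) (*-comm y x)) })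
    (λ { refl → begin
      inv y y≢0 * z * y    ≡⟨ *-assoc _ z y ⟩
      inv y y≢0 * (z * y)  ≡⟨ cong (inv y y≢0 *_) (*-comm z y) ⟩
      inv y y≢0 * (y * z)  ≡⟨ inv-cancelˡ y≢0 z ⟩
      z                    ∎ })

  pow-+ : ∀ x m n → pow x (m ℕ.+ n) ≡ pow x m * pow x n
  pow-+ x zero    n = sym (*-identityˡ _)
  pow-+ x (suc m) n = trans (cong (x *_) (pow-+ x m n)) (sym (*-assoc x _ _))

  pow-* : ∀ x m n → pow x (m ℕ.* n) ≡ pow (pow x n) m
  pow-* x zero    n = refl
  pow-* x (suc m) n = trans (pow-+ x n (m ℕ.* n)) (cong (pow x n *_) (pow-* x m n))

  pow-distrib-* : ∀ x y n → pow (x * y) n ≡ pow x n * pow y n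
  pow-distrib-* x y zero    = sym (*-identityˡ 1#)
  pow-distrib-* x y (suc n) =
    trans (cong (x * y *_) (pow-distrib-* x y n)) (*-interchange x y (pow x n) (pow y n))

  pow-1# : ∀ n → pow 1# n ≡ 1#
  pow-1# zero    = refl
  pow-1# (suc n) = trans (*-identityˡ _) (pow-1# n)

  pow-0# : ∀ n → pow 0# (suc n) ≡ 0#
  pow-0# n = zeroˡ _

  pow-≢0 : ∀ {x} n → x ≢ 0# → pow x n ≢ 0#
  pow-≢0 zero    x≢0 = 0≢1 ∘ sym
  pow-≢0 (suc n) x≢0 = *-≢0 x≢0 (pow-≢0 n x≢0)

  units : List F
  units = filter (λ x → ¬? (x ≟ 0#)) elems

  ∈-units⇔ : ∀ {x} → x ∈ units ⇔ x ≢ 0#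
  ∈-units⇔ = mk⇔ (proj₂ ∘ ∈-filter⁻ (λ x → ¬? (x ≟ 0#)) {xs = elems})
                 (∈-filter⁺ _ (elems-complete _))

  units-unique : Unique units
  units-unique = Unique.filter⁺ _ elems-unique

  elems↭0∷units : elems ↭ 0# ∷ units
  elems↭0∷units = unique∧set⇒↭ elems-unique (0∉units ∷ units-unique)
                               (λ {z} → mk⇔ (λ _ → split z) (λ _ → elems-complete z))
    where
    0∉units = All.tabulate (λ x∈units → Equivalence.to ∈-units⇔ x∈units ∘ sym)
    split : ∀ z → z ∈ 0# ∷ units
    split z with z ≟ 0#
    ... | yes refl = here refl
    ... | no z≢0   = there (Equivalence.from ∈-units⇔ z≢0)

  length-units : length units ≡ q ∸ 1
  length-units = sym (cong (ℕ._∸ 1) (↭-length elems↭0∷units))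

  x*-units↭units : ∀ {x} → x ≢ 0# → map (x *_) units ↭ units
  x*-units↭units {x} x≢0 = unique∧set⇒↭
    (Unique.map⁺ (*-cancelˡ-≢0 x≢0) units-unique) units-unique (mk⇔ to from)
    where
    to : ∀ {z} → z ∈ map (x *_) units → z ∈ units
    to z∈ with ∈-map⁻ (x *_) z∈
    ... | y , y∈units , refl =
      Equivalence.from ∈-units⇔ (*-≢0 x≢0 (Equivalence.to ∈-units⇔ y∈units))
    from : ∀ {z} → z ∈ units → z ∈ map (x *_) units
    from {z} z∈units = subst (_∈ map (x *_) units) x*x⁻¹z≡z (∈-map⁺ (x *_) x⁻¹z∈units)
      where
      x⁻¹z∈units : inv x x≢0 * z ∈ units
      x⁻¹z∈units = Equivalence.from ∈-units⇔
        (*-≢0 (inv-≢0 x≢0) (Equivalence.to ∈-units⇔ z∈units))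
      x*x⁻¹z≡z : x * (inv x x≢0 * z) ≡ z
      x*x⁻¹z≡z = trans (*-comm x _) (Equivalence.from (*≡⇔≡inv* x≢0) refl)

  product : List F → F
  product = foldr _*_ 1#

  product-↭ : ∀ {xs ys} → xs ↭ ys → product xs ≡ product ys
  product-↭ xs↭ys =
    Permutation.foldr-commMonoid (setoid F) *-isCommutativeMonoid (↭⇒↭ₛ xs↭ys)

  product-map-x* : ∀ x ys → product (map (x *_) ys) ≡ pow x (length ys) * product ys
  product-map-x* x []       = sym (*-identityˡ 1#)
  product-map-x* x (y ∷ ys) = trans (cong (x * y *_) (product-map-x* x ys))
                                    (*-interchange x y (pow x (length ys)) (product ys))

  product-≢0 : ∀ {ys} → (∀ {y} → y ∈ ys → y ≢ 0#) → product ys ≢ 0#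
  product-≢0 {[]}     _    = 0≢1 ∘ sym
  product-≢0 {y ∷ ys} ys≢0 = *-≢0 (ys≢0 (here refl)) (product-≢0 (ys≢0 ∘ there))

  pow-[q-1]≡1 : ∀ {x} → x ≢ 0# → pow x (q ∸ 1) ≡ 1#
  pow-[q-1]≡1 {x} x≢0 = *-cancelˡ-≢0 U≢0 (begin
    U * pow x (q ∸ 1)           ≡⟨ *-comm U _ ⟩
    pow x (q ∸ 1) * U           ≡⟨ cong (λ k → pow x k * U) length-units ⟨
    pow x (length units) * U    ≡⟨ product-map-x* x units ⟨
    product (map (x *_) units)  ≡⟨ product-↭ (x*-units↭units x≢0) ⟩
    U                           ≡⟨ *-identityʳ U ⟨
    U * 1#                      ∎)
    where
    U = product units
    U≢0 : U ≢ 0#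
    U≢0 = product-≢0 (Equivalence.to ∈-units⇔)

  pow-order-one : ∀ {z} m → pow z m ≡ 1# → pow z (suc m) ≡ 1# → z ≡ 1#
  pow-order-one {z} m zᵐ≡1 zᵐ⁺¹≡1 = begin
    z              ≡⟨ *-identityʳ z ⟨
    z * 1#         ≡⟨ cong (z *_) zᵐ≡1 ⟨
    pow z (suc m)  ≡⟨ zᵐ⁺¹≡1 ⟩
    1#             ∎

  pow≡1⇒≡1 : ∀ {b z} → Coprime b (q ∸ 1) → z ≢ 0# → pow z b ≡ 1# → z ≡ 1#
  pow≡1⇒≡1 {b} {z} b⊥q-1 z≢0 zᵇ≡1 = fromBézout (coprime-Bézout b⊥q-1)
    where
    z^Xb≡1 : ∀ X → pow z (X ℕ.* b) ≡ 1#
    z^Xb≡1 X = trans (pow-* z X b) (trans (cong (λ y → pow y X) zᵇ≡1) (pow-1# X))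
    z^Y[q-1]≡1 : ∀ Y → pow z (Y ℕ.* (q ∸ 1)) ≡ 1#
    z^Y[q-1]≡1 Y = trans (pow-* z Y (q ∸ 1))
                         (trans (cong (λ y → pow y Y) (pow-[q-1]≡1 z≢0)) (pow-1# Y))
    fromBézout : Bézout.Identity 1 b (q ∸ 1) → z ≡ 1#
    fromBézout (Bézout.+- X Y 1+Y[q-1]≡Xb) = pow-order-one (Y ℕ.* (q ∸ 1))
      (z^Y[q-1]≡1 Y) (trans (cong (pow z) 1+Y[q-1]≡Xb) (z^Xb≡1 X))
    fromBézout (Bézout.-+ X Y 1+Xb≡Y[q-1]) = pow-order-one (X ℕ.* b)
      (z^Xb≡1 X) (trans (cong (pow z) 1+Xb≡Y[q-1]) (z^Y[q-1]≡1 Y))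

  pow-injective : ∀ {b x y} → 1 ≤ b → Coprime b (q ∸ 1) → pow x b ≡ pow y b → x ≡ y
  pow-injective {suc b} {x} {y} (ℕ.s≤s _) b⊥q-1 xᵇ≡yᵇ with y ≟ 0#
  ... | yes refl = decidable-stable (x ≟ 0#)
                     (λ x≢0 → pow-≢0 (suc b) x≢0 (trans xᵇ≡yᵇ (pow-0# b)))
  ... | no y≢0 = begin
    x       ≡⟨ Equivalence.from (*≡⇔≡inv* y≢0) refl ⟨
    z * y   ≡⟨ cong (_* y) (pow≡1⇒≡1 b⊥q-1 z≢0 zᵇ≡1) ⟩
    1# * y  ≡⟨ *-identityˡ y ⟩
    y       ∎
    where
    y⁻¹ = inv y y≢0
    z = y⁻¹ * x
    zᵇ≡1 : pow z (suc b) ≡ 1#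
    zᵇ≡1 = begin
      pow z (suc b)                      ≡⟨ pow-distrib-* y⁻¹ x (suc b) ⟩
      pow y⁻¹ (suc b) * pow x (suc b)    ≡⟨ cong (pow y⁻¹ (suc b) *_) xᵇ≡yᵇ ⟩
      pow y⁻¹ (suc b) * pow y (suc b)    ≡⟨ pow-distrib-* y⁻¹ y (suc b) ⟨
      pow (y⁻¹ * y) (suc b)              ≡⟨ cong (λ w → pow w (suc b)) (inverseˡ y≢0) ⟩
      pow 1# (suc b)                     ≡⟨ pow-1# (suc b) ⟩
      1#                                 ∎
    z≢0 : z ≢ 0#
    z≢0 z≡0 = 0≢1 (trans (sym (pow-0# b)) (subst (λ w → pow w (suc b) ≡ 1#) z≡0 zᵇ≡1))

  ∑-allVec-∷ : ∀ k g → ∑ (allVec (suc k)) g ≡ ∑ elems (λ x → ∑ (allVec k) (λ v → g (x ∷ v)))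
  ∑-allVec-∷ k = ∑-concatMap-∷ elems (allVec k)

  ∑-allVec-∷ʳ : ∀ k g →
                ∑ (allVec (suc k)) g ≡ ∑ (allVec k) (λ v → ∑ elems (λ x → g (v ∷ʳ x)))
  ∑-allVec-∷ʳ zero    g = trans (∑-allVec-∷ zero g)
    (trans (∑-cong elems (λ x → ℕ.+-identityʳ (g (x ∷ [])))) (sym (ℕ.+-identityʳ _)))
  ∑-allVec-∷ʳ (suc k) g = begin
    ∑ (allVec (suc (suc k))) g
      ≡⟨ ∑-allVec-∷ (suc k) g ⟩
    ∑ elems (λ x → ∑ (allVec (suc k)) (λ v → g (x ∷ v)))
      ≡⟨ ∑-cong elems (λ x → ∑-allVec-∷ʳ k _) ⟩
    ∑ elems (λ x → ∑ (allVec k) (λ v → ∑ elems (λ y → g (x ∷ (v ∷ʳ y)))))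
      ≡⟨ ∑-allVec-∷ k _ ⟨
    ∑ (allVec (suc k)) (λ v → ∑ elems (λ y → g (v ∷ʳ y)))
      ∎

  ∑-allVec-1 : ∀ k → ∑ (allVec k) (λ _ → 1) ≡ q ℕ.^ k
  ∑-allVec-1 zero    = refl
  ∑-allVec-1 (suc k) =
    trans (∑-allVec-∷ k _) (trans (∑-cong elems (λ _ → ∑-allVec-1 k)) (∑-const elems _))

  ∑-allVec-delta : ∀ {k} (v : Vec F k) {g : Vec F k → ℕ} → (∀ w → w ≢ v → g w ≡ 0) →
                   ∑ (allVec k) g ≡ g v
  ∑-allVec-delta []                  g≡0 = ℕ.+-identityʳ _
  ∑-allVec-delta {suc k} (x ∷ v) {g} g≡0 = begin
    ∑ (allVec (suc k)) g                            ≡⟨ ∑-allVec-∷ k g ⟩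
    ∑ elems (λ y → ∑ (allVec k) (λ w → g (y ∷ w)))  ≡⟨ ∑-delta elems-unique x∈elems off-x ⟩
    ∑ (allVec k) (λ w → g (x ∷ w))                  ≡⟨ ∑-allVec-delta v off-v ⟩
    g (x ∷ v)                                       ∎
    where
    x∈elems = elems-complete x
    off-x : ∀ y → y ≢ x → ∑ (allVec k) (λ w → g (y ∷ w)) ≡ 0
    off-x y y≢x = ∑-zero (allVec k) (λ _ → g≡0 _ (y≢x ∘ Vec.∷-injectiveˡ))
    off-v : ∀ w → w ≢ v → g (x ∷ w) ≡ 0
    off-v w w≢v = g≡0 _ (w≢v ∘ Vec.∷-injectiveʳ)

  ∑-𝟙≟-* : ∀ v (g : F → ℕ) → ∑ elems (λ x → 𝟙 (x ≟ v) ℕ.* g x) ≡ g v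
  ∑-𝟙≟-* v g = begin
    ∑ elems (λ x → 𝟙 (x ≟ v) ℕ.* g x)  ≡⟨ ∑-delta elems-unique (elems-complete v) off-v ⟩
    𝟙 (v ≟ v) ℕ.* g v                  ≡⟨ cong (ℕ._* g v) (if-yes (v ≟ v) refl) ⟩
    1 ℕ.* g v                          ≡⟨ ℕ.*-identityˡ (g v) ⟩
    g v                                ∎
    where
    off-v : ∀ x → x ≢ v → 𝟙 (x ≟ v) ℕ.* g x ≡ 0
    off-v x x≢v = cong (ℕ._* g x) (if-no (x ≟ v) x≢v)

  ∑-𝟙≟ : ∀ v → ∑ elems (λ x → 𝟙 (x ≟ v)) ≡ 1
  ∑-𝟙≟ v = trans (∑-cong elems (λ x → sym (ℕ.*-identityʳ (𝟙 (x ≟ v))))) (∑-𝟙≟-* v (λ _ → 1))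

  infixl 7 _·_
  _·_ : ∀ {k} → Vec F k → (Fin k → F) → F
  a · w = Σᶠ (λ j → lookup a j * w j)

  ·-distrib-- : ∀ {k} (a : Vec F k) w w′ → a · w - a · w′ ≡ a · (λ j → w j - w′ j)
  ·-distrib-- []      w w′ = -‿inverseʳ 0#
  ·-distrib-- (x ∷ a) w w′ = begin
    (x * w fzero + a · w₊) - (x * w′ fzero + a · w′₊)    ≡⟨ +-−-interchange _ _ _ _ ⟩
    (x * w fzero - x * w′ fzero) + (a · w₊ - a · w′₊)    ≡⟨ cong₂ _+_ (sym (x[y-z]≈xy-xz x _ _))
                                                                      (·-distrib-- a w₊ w′₊) ⟩
    x * (w fzero - w′ fzero) + a · (λ j → w₊ j - w′₊ j)  ∎
    where
    w₊ w′₊ : Fin _ → F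
    w₊  = w ∘ fsuc
    w′₊ = w′ ∘ fsuc

  #solutions : ∀ {k} (δ : Fin k → F) σ j → δ j ≢ 0# →
               ∑ (allVec k) (λ a → 𝟙 ((a · δ) ≟ σ)) ≡ q ℕ.^ (k ∸ 1)
  #solutions {suc k} δ σ fzero δ₀≢0 = begin
    ∑ (allVec (suc k)) (λ a → 𝟙 ((a · δ) ≟ σ))                      ≡⟨ ∑-allVec-∷ k _ ⟩
    ∑ elems (λ x → ∑ (allVec k) (λ a → 𝟙 ((x * δ₀ + a · δ₊) ≟ σ)))  ≡⟨ ∑-comm elems (allVec k) _ ⟩
    ∑ (allVec k) (λ a → ∑ elems (λ x → 𝟙 ((x * δ₀ + a · δ₊) ≟ σ)))  ≡⟨ ∑-cong (allVec k) unique-x ⟩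
    ∑ (allVec k) (λ _ → 1)                                          ≡⟨ ∑-allVec-1 k ⟩
    q ℕ.^ k                                                         ∎
    where
    δ₀ = δ fzero
    δ₊ = δ ∘ fsuc
    unique-x : ∀ a → ∑ elems (λ x → 𝟙 ((x * δ₀ + a · δ₊) ≟ σ)) ≡ 1
    unique-x a = begin
      ∑ elems (λ x → 𝟙 ((x * δ₀ + a · δ₊) ≟ σ))
        ≡⟨ ∑-cong elems (λ x → 𝟙-cong ((x * δ₀ + a · δ₊) ≟ σ) (x ≟ x₀) solve) ⟩
      ∑ elems (λ x → 𝟙 (x ≟ x₀))
        ≡⟨ ∑-𝟙≟ x₀ ⟩
      1
        ∎
      where
      x₀ = inv δ₀ δ₀≢0 * (σ - a · δ₊)
      solve : ∀ {x} → x * δ₀ + a · δ₊ ≡ σ ⇔ x ≡ x₀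
      solve = ⇔-trans +≡⇔≡- (*≡⇔≡inv* δ₀≢0)
  #solutions {suc (suc k)} δ σ (fsuc j) δⱼ≢0 = begin
    ∑ (allVec (suc (suc k))) (λ a → 𝟙 ((a · δ) ≟ σ))
      ≡⟨ ∑-allVec-∷ (suc k) _ ⟩
    ∑ elems (λ x → ∑ (allVec (suc k)) (λ a → 𝟙 ((x * δ₀ + a · δ₊) ≟ σ)))
      ≡⟨ ∑-cong elems (λ x → ∑-cong (allVec (suc k)) (λ a →
           𝟙-cong ((x * δ₀ + a · δ₊) ≟ σ) ((a · δ₊) ≟ (σ - x * δ₀)) +≡⇔≡-ʳ)) ⟩
    ∑ elems (λ x → ∑ (allVec (suc k)) (λ a → 𝟙 ((a · δ₊) ≟ (σ - x * δ₀))))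
      ≡⟨ ∑-cong elems (λ x → #solutions δ₊ _ j δⱼ≢0) ⟩
    ∑ elems (λ _ → q ℕ.^ k)
      ≡⟨ ∑-const elems _ ⟩
    q ℕ.^ suc k
      ∎
    where
    δ₀ = δ fzero
    δ₊ = δ ∘ fsuc

  -ᵛ≡0ᵛ⇔≡ : ∀ {k} {u v : Vec F k} → u -ᵛ v ≡ 0ᵛ ⇔ u ≡ v
  -ᵛ≡0ᵛ⇔≡ {u = []}    {[]}    = mk⇔ (λ _ → refl) (λ _ → refl)
  -ᵛ≡0ᵛ⇔≡ {u = x ∷ u} {y ∷ v} = mk⇔
    (λ e → cong₂ _∷_ (Equivalence.to -≡0⇔≡ (Vec.∷-injectiveˡ e))
                     (Equivalence.to -ᵛ≡0ᵛ⇔≡ (Vec.∷-injectiveʳ e)))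
    (λ e → cong₂ _∷_ (Equivalence.from -≡0⇔≡ (Vec.∷-injectiveˡ e))
                     (Equivalence.from -ᵛ≡0ᵛ⇔≡ (Vec.∷-injectiveʳ e)))

  ⋆-xᵇ : ∀ {m} (g : GA m) v u → (g ⋆ xᵇ v) u ≡ g (u -ᵛ v)
  ⋆-xᵇ g v u = begin
    ∑ (allVec _) (λ w → g (u -ᵛ w) ℕ.* 𝟙 (w ≟ᵛ v))  ≡⟨ ∑-allVec-delta v off-v ⟩
    g (u -ᵛ v) ℕ.* 𝟙 (v ≟ᵛ v)                        ≡⟨ cong (g (u -ᵛ v) ℕ.*_) v≟v≡1 ⟩
    g (u -ᵛ v) ℕ.* 1                                 ≡⟨ ℕ.*-identityʳ _ ⟩
    g (u -ᵛ v)                                       ∎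
    where
    v≟v≡1 : 𝟙 (v ≟ᵛ v) ≡ 1
    v≟v≡1 = if-yes (v ≟ᵛ v) refl
    off-v : ∀ w → w ≢ v → g (u -ᵛ w) ℕ.* 𝟙 (w ≟ᵛ v) ≡ 0
    off-v w w≢v = trans (cong (g (u -ᵛ w) ℕ.*_) (if-no (w ≟ᵛ v) w≢v)) (ℕ.*-zeroʳ (g (u -ᵛ w)))

  Σᶠ-cong : ∀ {k} {g h : Fin k → F} → (∀ j → g j ≡ h j) → Σᶠ g ≡ Σᶠ h
  Σᶠ-cong {zero}  g≗h = refl
  Σᶠ-cong {suc k} g≗h = cong₂ _+_ (g≗h fzero) (Σᶠ-cong (g≗h ∘ fsuc))

  monomials : ∀ {k} → Vec ℕ k → Vec F k → Fin k → F
  monomials bᵢ x j = pow (lookup x j) (lookup bᵢ j)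

  fa-∷ʳ : ∀ {k} (bᵢ : Vec ℕ k) a′ c x → fa bᵢ (a′ ∷ʳ c) x ≡ a′ · monomials bᵢ x + c
  fa-∷ʳ bᵢ a′ c x = cong₂ _+_
    (Σᶠ-cong (λ j → cong (_* monomials bᵢ x j) (lookup-∷ʳ-inject₁ a′ c j)))
    (lookup-∷ʳ-fromℕ a′ c)

module Incidence (𝔽 : FiniteField) {n d : ℕ}
                 (h : Fin d → FiniteField.Poly 𝔽 n) (b : Fin d → Vec ℕ n) where

  open FiniteField 𝔽
  open FiniteFieldProperties 𝔽
  open ≡-Reasoning

  base : Vec F (n ℕ.+ d) → Vec F n
  base = take n

  fibre : Vec F (n ℕ.+ d) → Fin d → F
  fibre p = lookup (drop n p)

  onGraph? : ∀ i (a : Vec F (suc n)) p →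
             Dec (fibre p i ≡ evalPoly (h i) (base p) + fa (b i) a (base p))
  onGraph? i a p = fibre p i ≟ (evalPoly (h i) (base p) + fa (b i) a (base p))

  #commonGraphs : Fin d → Vec F (n ℕ.+ d) → Vec F (n ℕ.+ d) → ℕ
  #commonGraphs i u v = ∑ (allVec (suc n)) (λ a → 𝟙 (onGraph? i a u) ℕ.* 𝟙 (onGraph? i a v))

  ∑-allRows-∏ : ∀ {k} (G : Fin k → Vec F (suc n) → ℕ) →
                ∑ (allRows h b) (λ r → ∏ (λ i → G i (lookup r i))) ≡
                ∏ (λ i → ∑ (allVec (suc n)) (G i))
  ∑-allRows-∏ {zero}  G = refl
  ∑-allRows-∏ {suc k} G = begin
    ∑ (allRows h b) (λ r → ∏ (λ i → G i (lookup r i)))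
      ≡⟨ ∑-concatMap-∷ 𝔸 (allRows h b) _ ⟩
    ∑ 𝔸 (λ a → ∑ (allRows h b) (λ r → G fzero a ℕ.* Π₊ r))
      ≡⟨ ∑-cong 𝔸 (λ a → ∑-*ˡ (allRows h b) (G fzero a) Π₊) ⟩
    ∑ 𝔸 (λ a → G fzero a ℕ.* ∑ (allRows h b) Π₊)
      ≡⟨ ∑-cong 𝔸 (λ a → cong (G fzero a ℕ.*_) (∑-allRows-∏ (G ∘ fsuc))) ⟩
    ∑ 𝔸 (λ a → G fzero a ℕ.* ∏ (λ i → ∑ 𝔸 (G (fsuc i))))
      ≡⟨ ∑-*ʳ 𝔸 _ (G fzero) ⟩
    ∑ 𝔸 (G fzero) ℕ.* ∏ (λ i → ∑ 𝔸 (G (fsuc i)))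
      ∎
    where
    𝔸 = allVec (suc n)
    Π₊ : Vec (Vec F (suc n)) k → ℕ
    Π₊ r = ∏ (λ i → G (fsuc i) (lookup r i))

  TᵀT≡∏#commonGraphs : ∀ u v → TᵀT h b u v ≡ ∏ (λ i → #commonGraphs i u v)
  TᵀT≡∏#commonGraphs u v = begin
    TᵀT h b u v
      ≡⟨ ∑-cong (allRows h b) (λ r → trans (cong₂ ℕ._*_ (𝟙-all (on? r u)) (𝟙-all (on? r v)))
                                           (sym (∏-distrib-* (𝟙 ∘ on? r u) (𝟙 ∘ on? r v)))) ⟩
    ∑ (allRows h b) (λ r → ∏ (λ i → 𝟙 (on? r u i) ℕ.* 𝟙 (on? r v i)))
      ≡⟨ ∑-allRows-∏ (λ i a → 𝟙 (onGraph? i a u) ℕ.* 𝟙 (onGraph? i a v)) ⟩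
    ∏ (λ i → #commonGraphs i u v)
      ∎
    where
    on? : ∀ r p i → _
    on? r p i = onGraph? i (lookup r i) p

  offset : Fin d → Vec F (n ℕ.+ d) → F
  offset i p = fibre p i - evalPoly (h i) (base p)

  τ : Fin d → Vec F (n ℕ.+ d) → Vec F n → F
  τ i p a′ = offset i p - a′ · monomials (b i) (base p)

  onGraph⇔ : ∀ i p a′ c →
             (fibre p i ≡ evalPoly (h i) (base p) + fa (b i) (a′ ∷ʳ c) (base p)) ⇔ c ≡ τ i p a′
  onGraph⇔ i p a′ c rewrite fa-∷ʳ (b i) a′ c (base p) =
    ⇔-trans (mk⇔ sym sym) (⇔-trans +≡⇔≡-ʳ +≡⇔≡-ʳ)

  #commonGraphs≡#agreements : ∀ i u v →
                              #commonGraphs i u v ≡ ∑ (allVec n) (λ a′ → 𝟙 (τ i u a′ ≟ τ i v a′))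
  #commonGraphs≡#agreements i u v = begin
    #commonGraphs i u v
      ≡⟨ ∑-allVec-∷ʳ n _ ⟩
    ∑ (allVec n) (λ a′ → ∑ elems (λ c → 𝟙 (onGraph? i (a′ ∷ʳ c) u) ℕ.* 𝟙 (onGraph? i (a′ ∷ʳ c) v)))
      ≡⟨ ∑-cong (allVec n) (λ a′ → ∑-cong elems (λ c →
           cong₂ ℕ._*_ (𝟙-cong (onGraph? i (a′ ∷ʳ c) u) (c ≟ τ i u a′) (onGraph⇔ i u a′ c))
                       (𝟙-cong (onGraph? i (a′ ∷ʳ c) v) (c ≟ τ i v a′) (onGraph⇔ i v a′ c)))) ⟩
    ∑ (allVec n) (λ a′ → ∑ elems (λ c → 𝟙 (c ≟ τ i u a′) ℕ.* 𝟙 (c ≟ τ i v a′)))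
      ≡⟨ ∑-cong (allVec n) (λ a′ → ∑-𝟙≟-* (τ i u a′) _) ⟩
    ∑ (allVec n) (λ a′ → 𝟙 (τ i u a′ ≟ τ i v a′))
      ∎

  #commonGraphs-diagonal : ∀ i u → #commonGraphs i u u ≡ q ℕ.^ n
  #commonGraphs-diagonal i u = begin
    #commonGraphs i u u
      ≡⟨ #commonGraphs≡#agreements i u u ⟩
    ∑ (allVec n) (λ a′ → 𝟙 (τ i u a′ ≟ τ i u a′))
      ≡⟨ ∑-cong (allVec n) (λ a′ → if-yes (τ i u a′ ≟ τ i u a′) refl) ⟩
    ∑ (allVec n) (λ _ → 1)
      ≡⟨ ∑-allVec-1 n ⟩
    q ℕ.^ n
      ∎

  #commonGraphs-sameBase : ∀ {i u v} → base u ≡ base v → fibre u i ≢ fibre v i →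
                           #commonGraphs i u v ≡ 0
  #commonGraphs-sameBase {i} {u} {v} base≡ fibre≢ = trans (#commonGraphs≡#agreements i u v)
    (∑-zero (allVec n) (λ {a′} _ → if-no (τ i u a′ ≟ τ i v a′) (fibre≢ ∘ τ-cancel a′)))
    where
    τ-cancel : ∀ a′ → τ i u a′ ≡ τ i v a′ → fibre u i ≡ fibre v i
    τ-cancel a′ τ≡τ = +-cancelʳ _ _ _ (+-cancelʳ _ _ _ (trans τ≡τ
      (cong (λ x → (fibre v i - evalPoly (h i) x) - a′ · monomials (b i) x) (sym base≡))))

  #commonGraphs-differentBase : ∀ {i u v} → (∀ j → 1 ≤ lookup (b i) j) →
                                (∀ j → Coprime (lookup (b i) j) (q ∸ 1)) →
                                base u ≢ base v → #commonGraphs i u v ≡ q ℕ.^ (n ∸ 1)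
  #commonGraphs-differentBase {i} {u} {v} b≥1 b⊥q-1 base≢ with ∃-lookup-≢ _≟_ base≢
  ... | j , uⱼ≢vⱼ = begin
    #commonGraphs i u v
      ≡⟨ #commonGraphs≡#agreements i u v ⟩
    ∑ (allVec n) (λ a′ → 𝟙 (τ i u a′ ≟ τ i v a′))
      ≡⟨ ∑-cong (allVec n) (λ a′ → 𝟙-cong (τ i u a′ ≟ τ i v a′) ((a′ · δ) ≟ σ) (τ≡τ⇔ a′)) ⟩
    ∑ (allVec n) (λ a′ → 𝟙 ((a′ · δ) ≟ σ))
      ≡⟨ #solutions δ σ j δⱼ≢0 ⟩
    q ℕ.^ (n ∸ 1)
      ∎
    where
    mᵤ mᵥ δ : Fin n → F
    mᵤ = monomials (b i) (base u)
    mᵥ = monomials (b i) (base v)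
    δ j = mᵤ j - mᵥ j
    σ = offset i u - offset i v
    δⱼ≢0 : δ j ≢ 0#
    δⱼ≢0 = uⱼ≢vⱼ ∘ pow-injective (b≥1 j) (b⊥q-1 j) ∘ Equivalence.to -≡0⇔≡
    τ≡τ⇔ : ∀ a′ → τ i u a′ ≡ τ i v a′ ⇔ a′ · δ ≡ σ
    τ≡τ⇔ a′ = ⇔-trans -≡-⇔-≡- (mk⇔ (λ e → trans (sym (·-distrib-- a′ mᵤ mᵥ)) (sym e))
                                     (λ e → sym (trans (·-distrib-- a′ mᵤ mᵥ) e)))

  take-−ᵛ≡0ᵛ⇔ : ∀ {u v} → take n (u -ᵛ v) ≡ 0ᵛ ⇔ base u ≡ base v
  take-−ᵛ≡0ᵛ⇔ {u} {v} = ⇔-trans (mk⇔ (trans (sym take-−ᵛ)) (trans take-−ᵛ)) -ᵛ≡0ᵛ⇔≡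
    where
    take-−ᵛ : take n (u -ᵛ v) ≡ base u -ᵛ base v
    take-−ᵛ = Vec.take-zipWith _ u v

  drop-≢ : ∀ {u v} → u ≢ v → base u ≡ base v → drop n u ≢ drop n v
  drop-≢ {u} {v} u≢v base≡ drop≡ = u≢v (begin
    u                      ≡⟨ Vec.take++drop≡id n u ⟨
    take n u ++ᵛ drop n u  ≡⟨ cong₂ _++ᵛ_ base≡ drop≡ ⟩
    take n v ++ᵛ drop n v  ≡⟨ Vec.take++drop≡id n v ⟩
    v                      ∎)

  ∏#commonGraphs≡fElem : (∀ i j → 1 ≤ lookup (b i) j) →
                         (∀ i j → Coprime (lookup (b i) j) (q ∸ 1)) →
                         ∀ u v → ∏ (λ i → #commonGraphs i u v) ≡ fElem n d (u -ᵛ v)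
  ∏#commonGraphs≡fElem b≥1 b⊥q-1 u v with u ≟ᵛ v | base u ≟ᵛ base v
  ... | yes refl | _ = begin
    ∏ (λ i → #commonGraphs i u u)  ≡⟨ ∏-cong (λ i → #commonGraphs-diagonal i u) ⟩
    ∏ {d} (λ _ → q ℕ.^ n)          ≡⟨ ∏-const-^ d q n ⟩
    q ℕ.^ (d ℕ.* n)                ≡⟨ if-yes ((u -ᵛ u) ≟ᵛ 0ᵛ) (Equivalence.from -ᵛ≡0ᵛ⇔≡ refl) ⟨
    fElem n d (u -ᵛ u)             ∎
  ... | no u≢v | yes base≡ with ∃-lookup-≢ _≟_ (drop-≢ u≢v base≡)
  ...   | i , fibre≢ = begin
    ∏ (λ i → #commonGraphs i u v)
      ≡⟨ ∏-zero _ i (#commonGraphs-sameBase base≡ fibre≢) ⟩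
    0
      ≡⟨ if-yes (take n (u -ᵛ v) ≟ᵛ 0ᵛ) (Equivalence.from take-−ᵛ≡0ᵛ⇔ base≡) ⟨
    (if does (take n (u -ᵛ v) ≟ᵛ 0ᵛ) then 0 else q ℕ.^ (d ℕ.* (n ∸ 1)))
      ≡⟨ if-no ((u -ᵛ v) ≟ᵛ 0ᵛ) (u≢v ∘ Equivalence.to -ᵛ≡0ᵛ⇔≡) ⟨
    fElem n d (u -ᵛ v)
      ∎
  ∏#commonGraphs≡fElem b≥1 b⊥q-1 u v | no u≢v | no base≢ = begin
    ∏ (λ i → #commonGraphs i u v)
      ≡⟨ ∏-cong (λ i → #commonGraphs-differentBase (b≥1 i) (b⊥q-1 i) base≢) ⟩
    ∏ {d} (λ _ → q ℕ.^ (n ∸ 1))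
      ≡⟨ ∏-const-^ d q (n ∸ 1) ⟩
    q ℕ.^ (d ℕ.* (n ∸ 1))
      ≡⟨ if-no (take n (u -ᵛ v) ≟ᵛ 0ᵛ) (base≢ ∘ Equivalence.to take-−ᵛ≡0ᵛ⇔) ⟨
    (if does (take n (u -ᵛ v) ≟ᵛ 0ᵛ) then 0 else q ℕ.^ (d ℕ.* (n ∸ 1)))
      ≡⟨ if-no ((u -ᵛ v) ≟ᵛ 0ᵛ) (u≢v ∘ Equivalence.to -ᵛ≡0ᵛ⇔≡) ⟨
    fElem n d (u -ᵛ v)
      ∎

open import Data.Nat using (_+_)
open FiniteField using (F; q; Poly; TotalDegree≤; φ; fElem; xᵇ; TᵀT)

lemma3p2 : (𝔽 : FiniteField) →
    (n d : ℕ) → 1 ≤ n → 1 ≤ d →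
    (h : Fin d → Poly 𝔽 n) → (∀ i → TotalDegree≤ 𝔽 (h i) (q 𝔽 ∸ 1)) →
    (b : Fin d → Vec ℕ n) →
    (∀ i j → 1 ≤ lookup (b i) j) →
    (∀ i j → Coprime (lookup (b i) j) (q 𝔽 ∸ 1)) →
    ∀ (u v : Vec (F 𝔽) (n + d)) →
      φ 𝔽 (fElem 𝔽 n d) (xᵇ 𝔽 v) u ≡ TᵀT 𝔽 h b u v
lemma3p2 𝔽 n d _ _ h _ b b≥1 b⊥q-1 u v = begin
  φ 𝔽 (fElem 𝔽 n d) (xᵇ 𝔽 v) u   ≡⟨ ⋆-xᵇ (fElem 𝔽 n d) v u ⟩
  fElem 𝔽 n d (u -ᵛ v)           ≡⟨ ∏#commonGraphs≡fElem b≥1 b⊥q-1 u v ⟨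
  ∏ (λ i → #commonGraphs i u v)  ≡⟨ TᵀT≡∏#commonGraphs u v ⟨
  TᵀT 𝔽 h b u v                  ∎
  where
  open FiniteField 𝔽 using (_-ᵛ_)
  open FiniteFieldProperties 𝔽 using (⋆-xᵇ)
  open Incidence 𝔽 h b using (#commonGraphs; TᵀT≡∏#commonGraphs; ∏#commonGraphs≡fElem)
  open ≡-Reasoning
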